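{- Let $\mathcal{G}$ be a hereditary class of graphs that is closed under substitution. Then for every graph $G\in\mathcal{G}^\#$, either $G\in\mathcal{G}$, or there exists a non-empty set $S\subseteq V_G$ such that $S$ is a homogeneous set in $G$ and $G[S]$ is decomposable.
   Context: Graphs are finite and simple, possibly empty. A class is hereditary if closed under isomorphism and induced subgraphs. Substitution (simultaneous form): for a non-empty graph $G_0$ with $V_{G_0}=\{v_1,\dots,v_t\}$ and non-empty graphs $G_1,\dots,G_t$ with pairwise disjoint vertex sets, $G$ is obtained by substituting $G_1,\dots,G_t$ for $v_1,\dots,v_t$ in $G_0$ if $V_G=\bigcup_i V_{G_i}$, $G[V_{G_i}]=G_i$, and for $i\neq j$, $V_{G_i}$ is complete to $V_{G_j}$ if $v_iv_j$ is an edge of $G_0$ and anti-complete otherwise; a class is closed under substitution if it is closed under this operation (equivalently, under substituting one graph for one vertex). Gluing along a clique: for non-empty graphs $G_1,G_2$ with inclusion-wise incomparable vertex sets such that $C=V_{G_1}\cap V_{G_2}$ is a (possibly empty) clique in both and $G_1[C]=G_2[C]$, the graph $G$ with $V_G=V_{G_1}\cup V_{G_2}$, $G[V_{G_i}]=G_i$, and $V_{G_1}\smallsetminus C$ anti-complete to $V_{G_2}\smallsetminus C$. $\mathcal{G}^\#$ is the closure of $\mathcal{G}$ under substitution and gluing along a clique. A non-empty set $S\subseteq V_G$ is homogeneous in $G$ if no vertex of $V_G\smallsetminus S$ has both a neighbor and a non-neighbor in $S$. For non-empty $G,G_0\in\mathcal{G}^\#$, $G$ is an expansion of $G_0$ if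 there are non-empty graphs $G_1,\dots,G_t\in\mathcal{G}^\#$ with pairwise disjoint vertex sets such that $G$ is obtained by substituting them for the vertices of $G_0$. A non-empty graph $G\in\mathcal{G}^\#$ is decomposable if there is a non-empty $G'\in\mathcal{G}^\#$ such that $G$ is an expansion of $G'$, and non-empty $H,K\in\mathcal{G}^\#$ with inclusion-wise incomparable vertex sets such that $G'$ is obtained by gluing $H$ and $K$ along a clique. -}

module Defs where

open import Data.Nat using (ℕ)
open import Data.Bool using (Bool; true; false)
open import Data.List using (List)
open import Data.List.Membership.Propositional using (_∈_; _∉_)
open import Data.Product using (Σ; ∃; ∃-syntax; _×_; _,_)
open import Data.Sum using (_⊎_)
open import Relation.Binary.PropositionalEquality using (_≡_; _≢_)
open import Relation.Nullary using (¬_)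
open import Data.Empty using (⊥)

-- Adjacency is a symmetric irreflexive Boolean relation; only its values
-- on V × V are meaningful.

record Graph : Set where
  field
    V      : List ℕ
    adj    : ℕ → ℕ → Bool
    sym    : ∀ u v → adj u v ≡ adj v u
    irrefl : ∀ v → adj v v ≡ false
open Graph public

_⊆ₗ_ : List ℕ → List ℕ → Set
A ⊆ₗ B = ∀ {x} → x ∈ A → x ∈ B

NonEmptySet : List ℕ → Set
NonEmptySet A = ∃[ x ] (x ∈ A)

NonEmpty : Graph → Set
NonEmpty G = NonEmptySet (V G)

Disjoint : List ℕ → List ℕ → Set
Disjoint A B = ∀ {x} → x ∈ A → x ∈ B → ⊥

-- induced subgraph G[S] (used with S ⊆ V G)
_[_] : Graph → List ℕ → Graph
G [ S ] = record { V = S ; adj = adj G ; sym = sym G ; irrefl = irrefl G }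

_≐_ : Graph → Graph → Set
G ≐ H = (∀ x → (x ∈ V G → x ∈ V H) × (x ∈ V H → x ∈ V G))
      × (∀ u v → u ∈ V G → v ∈ V G → adj G u v ≡ adj H u v)

record Iso (G H : Graph) : Set where
  field
    f      : ℕ → ℕ
    g      : ℕ → ℕ
    f-into : ∀ {x} → x ∈ V G → f x ∈ V H
    g-into : ∀ {y} → y ∈ V H → g y ∈ V G
    gf     : ∀ {x} → x ∈ V G → g (f x) ≡ x
    fg     : ∀ {y} → y ∈ V H → f (g y) ≡ y
    pres   : ∀ {u v} → u ∈ V G → v ∈ V G → adj H (f u) (f v) ≡ adj G u v

Class : Set₁
Class = Graph → Set

Hereditary : Class → Set
Hereditary 𝒢 = (∀ G H → Iso G H → 𝒢 G → 𝒢 H)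
             × (∀ G S → S ⊆ₗ V G → 𝒢 G → 𝒢 (G [ S ]))

record IsSubstitution (G0 : Graph) (F : ℕ → Graph) (G : Graph) : Set where
  field
    G0-nonempty : NonEmpty G0
    F-nonempty  : ∀ {v} → v ∈ V G0 → NonEmpty (F v)
    F-disjoint  : ∀ {v w} → v ∈ V G0 → w ∈ V G0 → v ≢ w → Disjoint (V (F v)) (V (F w))
    vertices    : ∀ x → (x ∈ V G → ∃[ v ] (v ∈ V G0 × x ∈ V (F v)))
                      × (∃[ v ] (v ∈ V G0 × x ∈ V (F v)) → x ∈ V G)
    induced     : ∀ {v} → v ∈ V G0 → (G [ V (F v) ]) ≐ F v
    between     : ∀ {v w x y} → v ∈ V G0 → w ∈ V G0 → v ≢ w →
                  x ∈ V (F v) → y ∈ V (F w) → adj G x y ≡ adj G0 v w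

ClosedUnderSubstitution : Class → Set
ClosedUnderSubstitution 𝒢 =
  ∀ G0 F G → IsSubstitution G0 F G → 𝒢 G0 → (∀ {v} → v ∈ V G0 → 𝒢 (F v)) → 𝒢 G

InBoth : Graph → Graph → ℕ → Set
InBoth G1 G2 x = x ∈ V G1 × x ∈ V G2

record IsGluing (G1 G2 : Graph) (G : Graph) : Set where
  field
    G1-nonempty  : NonEmpty G1
    G2-nonempty  : NonEmpty G2
    incomp₁      : ¬ (V G1 ⊆ₗ V G2)
    incomp₂      : ¬ (V G2 ⊆ₗ V G1)
    clique₁      : ∀ {u v} → InBoth G1 G2 u → InBoth G1 G2 v → u ≢ v → adj G1 u v ≡ true
    clique₂      : ∀ {u v} → InBoth G1 G2 u → InBoth G1 G2 v → u ≢ v → adj G2 u v ≡ true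
    same-on-C    : ∀ {u v} → InBoth G1 G2 u → InBoth G1 G2 v → adj G1 u v ≡ adj G2 u v
    vertices     : ∀ x → (x ∈ V G → x ∈ V G1 ⊎ x ∈ V G2)
                       × (x ∈ V G1 ⊎ x ∈ V G2 → x ∈ V G)
    induced₁     : (G [ V G1 ]) ≐ G1
    induced₂     : (G [ V G2 ]) ≐ G2
    anticomplete : ∀ {x y} → x ∈ V G1 → x ∉ V G2 → y ∈ V G2 → y ∉ V G1 →
                   adj G x y ≡ false

data Sharp (𝒢 : Class) : Graph → Set where
  base  : ∀ {G} → 𝒢 G → Sharp 𝒢 G
  subst : ∀ {G0 F G} → IsSubstitution G0 F G → Sharp 𝒢 G0 →
          (∀ {v} → v ∈ V G0 → Sharp 𝒢 (F v)) → Sharp 𝒢 G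
  glue  : ∀ {G1 G2 G} → IsGluing G1 G2 G → Sharp 𝒢 G1 → Sharp 𝒢 G2 → Sharp 𝒢 G

Homogeneous : Graph → List ℕ → Set
Homogeneous G S = NonEmptySet S × S ⊆ₗ V G ×
  (∀ {x} → x ∈ V G → x ∉ S →
     ¬ ((∃[ y ] (y ∈ S × adj G x y ≡ true)) × (∃[ z ] (z ∈ S × adj G x z ≡ false))))

Expansion : Class → Graph → Graph → Set
Expansion 𝒢 G G0 = NonEmpty G × Sharp 𝒢 G × NonEmpty G0 × Sharp 𝒢 G0 ×
  ∃[ F ] ((∀ {v} → v ∈ V G0 → NonEmpty (F v) × Sharp 𝒢 (F v)) × IsSubstitution G0 F G)

Decomposable : Class → Graph → Set
Decomposable 𝒢 G = NonEmpty G × Sharp 𝒢 G ×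
  ∃[ G' ] (NonEmpty G' × Sharp 𝒢 G' × Expansion 𝒢 G G' ×
    ∃[ H ] ∃[ K ] (NonEmpty H × Sharp 𝒢 H × NonEmpty K × Sharp 𝒢 K × IsGluing H K G'))

-- A gluing is itself decomposable
-- (the trivial expansion by singletons, which lie in 𝒢^# because 𝒢 is
-- hereditary), so all its vertices form the required set.  For a substitution
-- of blocks F v into G0: a homogeneous set of a block stays homogeneous in G;
-- if every block lies in 𝒢 we recurse into G0, and either G ∈ 𝒢 by closure
-- under substitution, or a decomposable homogeneous set S0 of G0 blows up to
-- the homogeneous set ⋃_{v ∈ S0} V(F v) of G, whose induced graph is an
-- expansion of G0[S0] and hence again decomposable.
module Submission where

open import Defs
open import Data.Nat using (ℕ; _≟_)
open import Data.Bool using (true; false)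
open import Data.List using (List; []; _∷_; concatMap)
open import Data.List.Relation.Unary.Any using (here; there)
open import Data.List.Membership.Propositional using (_∈_; _∉_; find; lose)
open import Data.List.Membership.Propositional.Properties using (∈-concatMap⁺; ∈-concatMap⁻)
open import Data.Product using (∃; ∃-syntax; _×_; _,_; proj₁; proj₂)
open import Data.Sum using (_⊎_; inj₁; inj₂)
open import Data.Empty using (⊥-elim)
open import Function using (_∘_; id)
open import Relation.Nullary using (¬_; yes; no)
open import Relation.Binary.PropositionalEquality as ≡ using (_≡_; _≢_; refl)

≐-refl : ∀ {G} → G ≐ G
≐-refl = (λ _ → id , id) , (λ _ _ _ _ → refl)

≐-sym : ∀ {G H} → G ≐ H → H ≐ G
≐-sym (same-V , same-adj) =
  (λ x → proj₂ (same-V x) , proj₁ (same-V x)) ,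
  (λ u v u∈ v∈ → ≡.sym (same-adj u v (proj₂ (same-V u) u∈) (proj₂ (same-V v) v∈)))

≐-trans : ∀ {G H K} → G ≐ H → H ≐ K → G ≐ K
≐-trans (V₁ , adj₁) (V₂ , adj₂) =
  (λ x → proj₁ (V₂ x) ∘ proj₁ (V₁ x) , proj₂ (V₁ x) ∘ proj₂ (V₂ x)) ,
  (λ u v u∈ v∈ → ≡.trans (adj₁ u v u∈ v∈) (adj₂ u v (proj₁ (V₁ u) u∈) (proj₁ (V₁ v) v∈)))

≐-[] : ∀ {G H S} → G ≐ H → S ⊆ₗ V G → (G [ S ]) ≐ (H [ S ])
≐-[] (_ , same-adj) S⊆ = (λ _ → id , id) , (λ u v u∈ v∈ → same-adj u v (S⊆ u∈) (S⊆ v∈))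

≐-[]-transport : ∀ {G H B X} → G ≐ H → X ⊆ₗ V G → (G [ X ]) ≐ B → (H [ X ]) ≐ B
≐-[]-transport {G} {H} {B} {X} G≐H X⊆ G[X]≐B =
  ≐-trans {H [ X ]} {G [ X ]} {B} (≐-sym {G [ X ]} {H [ X ]} (≐-[] {G} {H} G≐H X⊆)) G[X]≐B

≐-[]-⊆ : ∀ {G B X S} → (G [ X ]) ≐ B → S ⊆ₗ X → (B [ S ]) ≐ (G [ S ])
≐-[]-⊆ {G} {B} {X} {S} G[X]≐B S⊆ = ≐-sym {G [ S ]} {B [ S ]} (≐-[] {G [ X ]} {B} G[X]≐B S⊆)

≐⇒Iso : ∀ {G H} → G ≐ H → Iso G H
≐⇒Iso (same-V , same-adj) = record
  { f = λ x → x ; g = λ x → x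
  ; f-into = λ {x} → proj₁ (same-V x)
  ; g-into = λ {y} → proj₂ (same-V y)
  ; gf = λ _ → refl ; fg = λ _ → refl
  ; pres = λ {u} {v} u∈ v∈ → ≡.sym (same-adj u v u∈ v∈)
  }

block⊆ : ∀ {G0 F G v} → IsSubstitution G0 F G → v ∈ V G0 → V (F v) ⊆ₗ V G
block⊆ {v = v} s v∈ {x} x∈ = proj₂ (IsSubstitution.vertices s x) (v , v∈ , x∈)

block-unique : ∀ {G0 F G v w x} → IsSubstitution G0 F G → v ∈ V G0 → w ∈ V G0 →
                  x ∈ V (F v) → x ∈ V (F w) → v ≡ w
block-unique {v = v} {w} s v∈ w∈ x∈Fv x∈Fw with v ≟ w
... | yes v≡w = v≡w
... | no v≢w  = ⊥-elim (IsSubstitution.F-disjoint s v∈ w∈ v≢w x∈Fv x∈Fw)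

IsSubstitution-resp : ∀ {G0 F G H} → IsSubstitution G0 F G → G ≐ H → IsSubstitution G0 F H
IsSubstitution-resp {F = F} {G} {H} s G≐H@(same-V , same-adj) = record
  { G0-nonempty = G0-nonempty
  ; F-nonempty  = F-nonempty
  ; F-disjoint  = F-disjoint
  ; vertices    = λ x → proj₁ (vertices x) ∘ proj₂ (same-V x) , proj₁ (same-V x) ∘ proj₂ (vertices x)
  ; induced     = λ {v} v∈ → ≐-[]-transport {G} {H} {F v} G≐H (block⊆ s v∈) (induced v∈)
  ; between     = λ v∈ w∈ v≢w x∈ y∈ →
      ≡.trans (≡.sym (same-adj _ _ (block⊆ s v∈ x∈) (block⊆ s w∈ y∈))) (between v∈ w∈ v≢w x∈ y∈)
  }
  where open IsSubstitution s

IsGluing-resp : ∀ {G1 G2 G H} → IsGluing G1 G2 G → G ≐ H → IsGluing G1 G2 H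
IsGluing-resp {G1} {G2} {G} {H} gl G≐H@(same-V , same-adj) = record
  { G1-nonempty  = G1-nonempty
  ; G2-nonempty  = G2-nonempty
  ; incomp₁      = incomp₁
  ; incomp₂      = incomp₂
  ; clique₁      = clique₁
  ; clique₂      = clique₂
  ; same-on-C    = same-on-C
  ; vertices     = λ x → proj₁ (vertices x) ∘ proj₂ (same-V x) , proj₁ (same-V x) ∘ proj₂ (vertices x)
  ; induced₁     = ≐-[]-transport {G} {H} {G1} G≐H (proj₂ (vertices _) ∘ inj₁) induced₁
  ; induced₂     = ≐-[]-transport {G} {H} {G2} G≐H (proj₂ (vertices _) ∘ inj₂) induced₂
  ; anticomplete = λ x∈₁ x∉₂ y∈₂ y∉₁ →
      ≡.trans (≡.sym (same-adj _ _ (proj₂ (vertices _) (inj₁ x∈₁)) (proj₂ (vertices _) (inj₂ y∈₂))))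
              (anticomplete x∈₁ x∉₂ y∈₂ y∉₁)
  }
  where open IsGluing gl

⋃ : (ℕ → Graph) → List ℕ → List ℕ
⋃ F = concatMap (V ∘ F)

∈-⋃⁺ : ∀ {F S v x} → v ∈ S → x ∈ V (F v) → x ∈ ⋃ F S
∈-⋃⁺ {F} v∈ x∈ = ∈-concatMap⁺ (V ∘ F) (lose v∈ x∈)

∈-⋃⁻ : ∀ {F S x} → x ∈ ⋃ F S → ∃[ v ] (v ∈ S × x ∈ V (F v))
∈-⋃⁻ {F} x∈ = find (∈-concatMap⁻ (V ∘ F) x∈)

all⊎any : ∀ {A : Set} {P Q : A → Set} (xs : List A) → (∀ {x} → x ∈ xs → P x ⊎ Q x) →
          (∀ {x} → x ∈ xs → P x) ⊎ ∃[ x ] (x ∈ xs × Q x)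
all⊎any []       _       = inj₁ λ ()
all⊎any (x ∷ xs) P⊎Q with P⊎Q (here refl) | all⊎any xs (P⊎Q ∘ there)
... | inj₂ q | _                    = inj₂ (x , here refl , q)
... | inj₁ _ | inj₂ (y , y∈ , q)    = inj₂ (y , there y∈ , q)
... | inj₁ p | inj₁ ps              = inj₁ λ { (here refl) → p ; (there y∈) → ps y∈ }

singleton⊆ : ∀ {v S} → v ∈ S → (v ∷ []) ⊆ₗ S
singleton⊆ v∈ (here refl) = v∈

IsSubstitution-singletons : ∀ {G} → NonEmpty G → IsSubstitution G (λ v → G [ v ∷ [] ]) G
IsSubstitution-singletons {G} ne = record
  { G0-nonempty = ne
  ; F-nonempty  = λ {v} _ → v , here refl
  ; F-disjoint  = λ { _ _ v≢w (here refl) (here refl) → v≢w refl }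
  ; vertices    = λ x → (λ x∈ → x , x∈ , here refl) , (λ { (_ , v∈ , here refl) → v∈ })
  ; induced     = λ {v} _ → ≐-refl {G [ v ∷ [] ]}
  ; between     = λ { _ _ _ (here refl) (here refl) → refl }
  }

IsSubstitution-restrict : ∀ {G0 F G S} → IsSubstitution G0 F G → NonEmptySet S → S ⊆ₗ V G0 →
                          IsSubstitution (G0 [ S ]) F (G [ ⋃ F S ])
IsSubstitution-restrict {F = F} {S = S} s ne S⊆ = record
  { G0-nonempty = ne
  ; F-nonempty  = F-nonempty ∘ S⊆
  ; F-disjoint  = λ v∈ w∈ → F-disjoint (S⊆ v∈) (S⊆ w∈)
  ; vertices    = λ _ → ∈-⋃⁻ {F} {S} , (λ { (_ , v∈ , x∈) → ∈-⋃⁺ {F} {S} v∈ x∈ })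
  ; induced     = induced ∘ S⊆
  ; between     = λ v∈ w∈ → between (S⊆ v∈) (S⊆ w∈)
  }
  where open IsSubstitution s

module _ {A F B H C} (s₁ : IsSubstitution A F B) (s₂ : IsSubstitution B H C) where

  private
    module S₁ = IsSubstitution s₁
    module S₂ = IsSubstitution s₂

  composite-block : ℕ → Graph
  composite-block a = C [ ⋃ H (V (F a)) ]

  IsSubstitution-inner : ∀ {a} → a ∈ V A → IsSubstitution (F a) H (composite-block a)
  IsSubstitution-inner {a} a∈ = record
    { G0-nonempty = S₁.F-nonempty a∈
    ; F-nonempty  = S₂.F-nonempty ∘ block⊆ s₁ a∈
    ; F-disjoint  = λ b∈ b′∈ → S₂.F-disjoint (block⊆ s₁ a∈ b∈) (block⊆ s₁ a∈ b′∈)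
    ; vertices    = λ _ → ∈-⋃⁻ {H} {V (F a)} , (λ { (_ , b∈ , x∈) → ∈-⋃⁺ {H} {V (F a)} b∈ x∈ })
    ; induced     = S₂.induced ∘ block⊆ s₁ a∈
    ; between     = λ {b} {b′} b∈ b′∈ b≢b′ x∈ y∈ →
        ≡.trans (S₂.between (block⊆ s₁ a∈ b∈) (block⊆ s₁ a∈ b′∈) b≢b′ x∈ y∈)
                (proj₂ (S₁.induced a∈) b b′ b∈ b′∈)
    }

  IsSubstitution-∘ : IsSubstitution A composite-block C
  IsSubstitution-∘ = record
    { G0-nonempty = S₁.G0-nonempty
    ; F-nonempty  = nonempty
    ; F-disjoint  = disjoint
    ; vertices    = λ x → outer x , inner x
    ; induced     = λ {a} _ → ≐-refl {composite-block a}
    ; between     = between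
    }
    where
    nonempty : ∀ {a} → a ∈ V A → NonEmpty (composite-block a)
    nonempty {a} a∈ with S₁.F-nonempty a∈
    ... | b , b∈ with S₂.F-nonempty (block⊆ s₁ a∈ b∈)
    ... | x , x∈ = x , ∈-⋃⁺ {H} {V (F a)} b∈ x∈

    disjoint : ∀ {a a′} → a ∈ V A → a′ ∈ V A → a ≢ a′ →
               Disjoint (⋃ H (V (F a))) (⋃ H (V (F a′)))
    disjoint {a} {a′} a∈ a′∈ a≢a′ x∈ x∈′
      with ∈-⋃⁻ {H} {V (F a)} x∈ | ∈-⋃⁻ {H} {V (F a′)} x∈′
    ... | b , b∈ , x∈Hb | b′ , b′∈ , x∈Hb′
      with block-unique s₂ (block⊆ s₁ a∈ b∈) (block⊆ s₁ a′∈ b′∈) x∈Hb x∈Hb′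
    ... | refl = S₁.F-disjoint a∈ a′∈ a≢a′ b∈ b′∈

    outer : ∀ x → x ∈ V C → ∃[ a ] (a ∈ V A × x ∈ ⋃ H (V (F a)))
    outer x x∈ with proj₁ (S₂.vertices x) x∈
    ... | b , b∈ , x∈Hb with proj₁ (S₁.vertices b) b∈
    ... | a , a∈ , b∈Fa = a , a∈ , ∈-⋃⁺ {H} {V (F a)} b∈Fa x∈Hb

    inner : ∀ x → ∃[ a ] (a ∈ V A × x ∈ ⋃ H (V (F a))) → x ∈ V C
    inner x (a , a∈ , x∈) with ∈-⋃⁻ {H} {V (F a)} x∈
    ... | b , b∈ , x∈Hb = block⊆ s₂ (block⊆ s₁ a∈ b∈) x∈Hb

    between : ∀ {a a′ x y} → a ∈ V A → a′ ∈ V A → a ≢ a′ →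
              x ∈ ⋃ H (V (F a)) → y ∈ ⋃ H (V (F a′)) → adj C x y ≡ adj A a a′
    between {a} {a′} a∈ a′∈ a≢a′ x∈ y∈
      with ∈-⋃⁻ {H} {V (F a)} x∈ | ∈-⋃⁻ {H} {V (F a′)} y∈
    ... | b , b∈ , x∈Hb | b′ , b′∈ , y∈Hb′ =
      ≡.trans (S₂.between (block⊆ s₁ a∈ b∈) (block⊆ s₁ a′∈ b′∈) b≢b′ x∈Hb y∈Hb′)
              (S₁.between a∈ a′∈ a≢a′ b∈ b′∈)
      where
      b≢b′ : b ≢ b′
      b≢b′ refl = S₁.F-disjoint a∈ a′∈ a≢a′ b∈ b′∈

Splits : Graph → ℕ → List ℕ → Set
Splits G x S = (∃[ y ] (y ∈ S × adj G x y ≡ true)) × (∃[ z ] (z ∈ S × adj G x z ≡ false))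

¬Splits-uniform : ∀ {G x S b} → (∀ {y} → y ∈ S → adj G x y ≡ b) → ¬ Splits G x S
¬Splits-uniform uniform ((_ , y∈ , xy) , (_ , z∈ , xz))
  with ≡.trans (≡.sym (uniform y∈)) xy | ≡.trans (≡.sym (uniform z∈)) xz
... | refl | ()

Homogeneous-V : ∀ {G} → NonEmpty G → Homogeneous G (V G)
Homogeneous-V ne = ne , id , λ x∈ x∉ _ → x∉ x∈

module _ {G0 F G} (s : IsSubstitution G0 F G) where

  open IsSubstitution s

  Homogeneous-block : ∀ {v S} → v ∈ V G0 → Homogeneous (F v) S → Homogeneous G S
  Homogeneous-block {v} {S} v∈ (ne , S⊆ , unsplit) = ne , block⊆ s v∈ ∘ S⊆ , unsplit′
    where
    unsplit′ : ∀ {x} → x ∈ V G → x ∉ S → ¬ Splits G x S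
    unsplit′ {x} x∈ x∉ ((y , y∈ , xy) , (z , z∈ , xz)) with proj₁ (vertices x) x∈
    ... | w , w∈ , x∈Fw with w ≟ v
    ... | yes refl = unsplit x∈Fw x∉ ((y , y∈ , ≡.trans (≡.sym (inside y∈)) xy) ,
                                      (z , z∈ , ≡.trans (≡.sym (inside z∈)) xz))
      where
      inside : ∀ {y} → y ∈ S → adj G x y ≡ adj (F v) x y
      inside y∈ = proj₂ (induced v∈) x _ x∈Fw (S⊆ y∈)
    ... | no w≢v = ¬Splits-uniform {G} {x} (λ y∈ → between w∈ v∈ w≢v x∈Fw (S⊆ y∈))
                                           ((y , y∈ , xy) , (z , z∈ , xz))

  -- x ∉ ⋃ F S0 puts the block of x outside S0, so x splits ⋃ F S0 exactly when
  -- that block's vertex splits S0 in G0.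
  Homogeneous-⋃ : ∀ {S0} → Homogeneous G0 S0 → Homogeneous G (⋃ F S0)
  Homogeneous-⋃ {S0} (ne , S0⊆ , unsplit) = ne′ , ⋃⊆ , unsplit′
    where
    ne′ : NonEmptySet (⋃ F S0)
    ne′ with F-nonempty (S0⊆ (proj₂ ne))
    ... | x , x∈ = x , ∈-⋃⁺ {F} {S0} (proj₂ ne) x∈

    ⋃⊆ : ⋃ F S0 ⊆ₗ V G
    ⋃⊆ x∈ with ∈-⋃⁻ {F} {S0} x∈
    ... | v , v∈ , x∈Fv = block⊆ s (S0⊆ v∈) x∈Fv

    unsplit′ : ∀ {x} → x ∈ V G → x ∉ ⋃ F S0 → ¬ Splits G x (⋃ F S0)
    unsplit′ {x} x∈ x∉ ((y , y∈ , xy) , (z , z∈ , xz))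
      with proj₁ (vertices x) x∈ | ∈-⋃⁻ {F} {S0} y∈ | ∈-⋃⁻ {F} {S0} z∈
    ... | w , w∈ , x∈Fw | b , b∈ , y∈Fb | d , d∈ , z∈Fd =
      unsplit w∈ w∉ ((b , b∈ , ≡.trans (≡.sym (across b∈ y∈Fb)) xy) ,
                     (d , d∈ , ≡.trans (≡.sym (across d∈ z∈Fd)) xz))
      where
      w∉ : w ∉ S0
      w∉ w∈S0 = x∉ (∈-⋃⁺ {F} {S0} w∈S0 x∈Fw)

      across : ∀ {b y} → b ∈ S0 → y ∈ V (F b) → adj G x y ≡ adj G0 w b
      across b∈ y∈Fb = between w∈ (S0⊆ b∈) (λ { refl → w∉ b∈ }) x∈Fw y∈Fb

DecomposableHomogeneousSet : Class → Graph → Set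
DecomposableHomogeneousSet 𝒢 G =
  ∃[ S ] (NonEmptySet S × S ⊆ₗ V G × Homogeneous G S × Decomposable 𝒢 (G [ S ]))

module _ {𝒢 : Class} where

  IsSubstitution⇒Expansion : ∀ {G0 F G} → IsSubstitution G0 F G → Sharp 𝒢 G0 →
                             (∀ {v} → v ∈ V G0 → Sharp 𝒢 (F v)) → Expansion 𝒢 G G0
  IsSubstitution⇒Expansion {G0} {F} {G} s sG0 sF =
    neG , subst s sG0 sF , G0-nonempty , sG0 , F , (λ v∈ → F-nonempty v∈ , sF v∈) , s
    where
    open IsSubstitution s
    neG : NonEmpty G
    neG with G0-nonempty
    ... | v , v∈ with F-nonempty v∈
    ... | x , x∈ = x , block⊆ s v∈ x∈

  Expansion-trans : ∀ {A B C} → Expansion 𝒢 B A → Expansion 𝒢 C B → Expansion 𝒢 C A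
  Expansion-trans {A} (_ , _ , neA , sA , F , F-ok , s₁) (neC , sC , _ , _ , H , H-ok , s₂) =
    neC , sC , neA , sA , composite-block s₁ s₂ , composite-ok , IsSubstitution-∘ s₁ s₂
    where
    composite-ok : ∀ {a} → a ∈ V A →
                   NonEmpty (composite-block s₁ s₂ a) × Sharp 𝒢 (composite-block s₁ s₂ a)
    composite-ok a∈ =
      IsSubstitution.F-nonempty (IsSubstitution-∘ s₁ s₂) a∈ ,
      subst (IsSubstitution-inner s₁ s₂ a∈) (proj₂ (F-ok a∈)) (proj₂ ∘ H-ok ∘ block⊆ s₁ a∈)

  Decomposable-expansion : ∀ {G G0} → Expansion 𝒢 G G0 → Decomposable 𝒢 G0 → Decomposable 𝒢 G
  Decomposable-expansion e@(neG , sG , _) (_ , _ , G′ , neG′ , sG′ , e′ , gluing) =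
    neG , sG , G′ , neG′ , sG′ , Expansion-trans e′ e , gluing

  DecomposableHomogeneousSet-⋃ : ∀ {G0 F G} → IsSubstitution G0 F G →
                                 (∀ {v} → v ∈ V G0 → Sharp 𝒢 (F v)) →
                                 DecomposableHomogeneousSet 𝒢 G0 → DecomposableHomogeneousSet 𝒢 G
  DecomposableHomogeneousSet-⋃ {F = F} {G} s sF (S0 , ne , S0⊆ , hom , dec@(_ , sG0[S0] , _)) =
    ⋃ F S0 , proj₁ hom′ , proj₁ (proj₂ hom′) , hom′ ,
    Decomposable-expansion
      (IsSubstitution⇒Expansion (IsSubstitution-restrict s ne S0⊆) sG0[S0] (sF ∘ S0⊆)) dec
    where
    hom′ : Homogeneous G (⋃ F S0)
    hom′ = Homogeneous-⋃ s hom

module _ {𝒢 : Class} (hered : Hereditary 𝒢) where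

  Sharp-resp : ∀ {G H} → Sharp 𝒢 G → G ≐ H → Sharp 𝒢 H
  Sharp-resp (base g)          G≐H = base (proj₁ hered _ _ (≐⇒Iso G≐H) g)
  Sharp-resp (subst s sG0 sF)  G≐H = subst (IsSubstitution-resp s G≐H) sG0 sF
  Sharp-resp (glue gl sG1 sG2) G≐H = glue (IsGluing-resp gl G≐H) sG1 sG2

  Sharp-singleton : ∀ {G v} → Sharp 𝒢 G → v ∈ V G → Sharp 𝒢 (G [ v ∷ [] ])
  Sharp-singleton {G} (base g) v∈ = base (proj₂ hered G _ (singleton⊆ v∈) g)
  Sharp-singleton {G} {v} (subst {F = F} s _ sF) v∈ with proj₁ (IsSubstitution.vertices s v) v∈
  ... | w , w∈ , v∈Fw =
    Sharp-resp (Sharp-singleton (sF w∈) v∈Fw)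
               (≐-[]-⊆ {G} {F w} (IsSubstitution.induced s w∈) (singleton⊆ v∈Fw))
  Sharp-singleton {G} {v} (glue {G1} {G2} gl sG1 sG2) v∈ with proj₁ (IsGluing.vertices gl v) v∈
  ... | inj₁ v∈₁ =
    Sharp-resp (Sharp-singleton sG1 v∈₁) (≐-[]-⊆ {G} {G1} (IsGluing.induced₁ gl) (singleton⊆ v∈₁))
  ... | inj₂ v∈₂ =
    Sharp-resp (Sharp-singleton sG2 v∈₂) (≐-[]-⊆ {G} {G2} (IsGluing.induced₂ gl) (singleton⊆ v∈₂))

  Expansion-singletons : ∀ {G H} → NonEmpty G → Sharp 𝒢 G → G ≐ H → Expansion 𝒢 H G
  Expansion-singletons ne sG G≐H =
    IsSubstitution⇒Expansion (IsSubstitution-resp (IsSubstitution-singletons ne) G≐H) sG (Sharp-singleton sG)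

  Decomposable-resp : ∀ {G H} → Decomposable 𝒢 G → G ≐ H → Decomposable 𝒢 H
  Decomposable-resp dec@(ne , sG , _) G≐H = Decomposable-expansion (Expansion-singletons ne sG G≐H) dec

  IsGluing⇒Decomposable : ∀ {G1 G2 G} → IsGluing G1 G2 G → Sharp 𝒢 G1 → Sharp 𝒢 G2 → Decomposable 𝒢 G
  IsGluing⇒Decomposable {G1} {G2} {G} gl sG1 sG2 =
    neG , sG , G , neG , sG , Expansion-singletons neG sG (≐-refl {G}) ,
    G1 , G2 , G1-nonempty , sG1 , G2-nonempty , sG2 , gl
    where
    open IsGluing gl
    sG : Sharp 𝒢 G
    sG = glue gl sG1 sG2
    neG : NonEmpty G
    neG = proj₁ G1-nonempty , proj₂ (vertices _) (inj₁ (proj₂ G1-nonempty))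

  DecomposableHomogeneousSet-glue : ∀ {G1 G2 G} → IsGluing G1 G2 G → Sharp 𝒢 G1 → Sharp 𝒢 G2 →
                                    DecomposableHomogeneousSet 𝒢 G
  DecomposableHomogeneousSet-glue {G = G} gl sG1 sG2 =
    V G , proj₁ dec , id , Homogeneous-V {G} (proj₁ dec) , dec
    where
    dec : Decomposable 𝒢 G
    dec = IsGluing⇒Decomposable gl sG1 sG2

  DecomposableHomogeneousSet-block : ∀ {G0 F G v} → IsSubstitution G0 F G → v ∈ V G0 →
                                     DecomposableHomogeneousSet 𝒢 (F v) → DecomposableHomogeneousSet 𝒢 G
  DecomposableHomogeneousSet-block {F = F} {G} {v} s v∈ (S , ne , S⊆ , hom , dec) =
    S , ne , block⊆ s v∈ ∘ S⊆ , Homogeneous-block s v∈ hom ,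
    Decomposable-resp dec (≐-[]-⊆ {G} {F v} (IsSubstitution.induced s v∈) S⊆)

lemma3p9 : (𝒢 : Class) → Hereditary 𝒢 → ClosedUnderSubstitution 𝒢 →
    ∀ G → Sharp 𝒢 G →
    𝒢 G ⊎ (∃[ S ] (NonEmptySet S × S ⊆ₗ V G × Homogeneous G S × Decomposable 𝒢 (G [ S ])))
lemma3p9 𝒢 hered closed G (base g) = inj₁ g
lemma3p9 𝒢 hered closed G (glue gl sG1 sG2) = inj₂ (DecomposableHomogeneousSet-glue hered gl sG1 sG2)
lemma3p9 𝒢 hered closed G (subst {G0} {F} s sG0 sF)
  with all⊎any (V G0) (λ {v} v∈ → lemma3p9 𝒢 hered closed (F v) (sF v∈))
... | inj₂ (v , v∈ , found) = inj₂ (DecomposableHomogeneousSet-block hered s v∈ found)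
... | inj₁ all∈𝒢 with lemma3p9 𝒢 hered closed G0 sG0
...   | inj₁ G0∈𝒢  = inj₁ (closed G0 F G s G0∈𝒢 all∈𝒢)
...   | inj₂ found = inj₂ (DecomposableHomogeneousSet-⋃ s sF found)
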